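{- Let $J\subseteq C(n,k+1)$ be a realizable $(k+1)$-set, let $\gamma$ be a path from $\emptyset$ to $J$ in $B(n,k)$, and let $X\in N(\gamma)$. Then $p_X(\gamma)$ is again a path from $\emptyset$ to $J$ in $B(n,k)$.
   Context: $C(n,m)$: $m$-subsets of $\{1,\dots,n\}$, lexicographic order on increasing sequences. For $X\in C(n,m+1)$, $P_X=\{Y\in C(n,m):Y\subset X\}$ with lexicographic order. For $A\subseteq C(n,m)$, $A$ is realizable if each $P_X\cap A$ ($X\in C(n,m+1)$) is an initial or final segment of $P_X$; $A_F=\{X\in C(n,m+1):P_X\subseteq A\}$. A path from $\emptyset$ to $J$ in $B(n,k)$ is a total order $\gamma$ on $J$ every prefix (initial segment) of which is a realizable subset of $C(n,k+1)$ (Ziegler's identification of $B(n,k)$ with realizable subsets of $C(n,k+1)$ under single-step inclusion). $N(\gamma)=\{X\in J_F: P_X\text{ forms a contiguous block in }\gamma\}$ (here $X\in C(n,k+2)$), and $p_X(\gamma)$ is the total order on $J$ obtained by reversing the block $P_X$ and keeping everything else. -}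

module Defs where

open import Data.Nat using (ℕ; suc; _<_; _≤_)
open import Data.List using (List; length; take; reverse; _++_)
open import Data.List.Relation.Unary.All using (All)
open import Data.List.Relation.Unary.Linked using (Linked)
open import Data.List.Relation.Binary.Lex.Strict using (Lex-<)
open import Data.List.Membership.Propositional using (_∈_)
open import Data.List.Relation.Unary.Unique.Propositional using (Unique)
open import Data.Product using (_×_)
open import Data.Sum using (_⊎_)
open import Relation.Binary.PropositionalEquality using (_≡_)
open import Function.Bundles using (_⇔_)

SetOf : Set₁
SetOf = List ℕ → Set

-- Y ∈ C(n,m): Y is a strictly increasing sequence of length m with entries in {1,…,n}.
InC : ℕ → ℕ → List ℕ → Set
InC n m Y = Linked _<_ Y × All (λ i → 1 ≤ i × i ≤ n) Y × length Y ≡ m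

_<lex_ : List ℕ → List ℕ → Set
_<lex_ = Lex-< _≡_ _<_

InP : ℕ → ℕ → List ℕ → List ℕ → Set
InP n m X Y = InC n m Y × All (_∈ X) Y

InitialIn : ℕ → ℕ → SetOf → List ℕ → Set
InitialIn n m A X = ∀ Y Y′ → InP n m X Y → InP n m X Y′ → Y′ <lex Y → A Y → A Y′

FinalIn : ℕ → ℕ → SetOf → List ℕ → Set
FinalIn n m A X = ∀ Y Y′ → InP n m X Y → InP n m X Y′ → Y <lex Y′ → A Y → A Y′

Realizable : ℕ → ℕ → SetOf → Set
Realizable n m A =
  (∀ Y → A Y → InC n m Y) ×
  (∀ X → InC n (suc m) X → InitialIn n m A X ⊎ FinalIn n m A X)

InF : ℕ → ℕ → SetOf → List ℕ → Set
InF n m A X = InC n (suc m) X × (∀ Y → InP n m X Y → A Y)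

⟦_⟧ : List (List ℕ) → SetOf
⟦ xs ⟧ Y = Y ∈ xs

-- γ is a path from ∅ to J in B(n,k): a total order (duplicate-free list) on J
-- every prefix of which is a realizable subset of C(n,k+1).
IsPath : ℕ → ℕ → SetOf → List (List ℕ) → Set
IsPath n k J γ =
  Unique γ ×
  (∀ Y → (Y ∈ γ) ⇔ J Y) ×
  (∀ i → Realizable n (suc k) ⟦ take i γ ⟧)

-- X ∈ N(γ): X ∈ J_F (X ∈ C(n,k+2)) and P_X forms a contiguous block of γ,
-- witnessed by a decomposition γ = α ++ β ++ δ with β exactly P_X.
record InN (n k : ℕ) (J : SetOf) (γ : List (List ℕ)) (X : List ℕ) : Set where
  field
    inJF  : InF n (suc k) J X
    α β δ : List (List ℕ)
    split : γ ≡ α ++ β ++ δ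
    block : ∀ Y → (Y ∈ β) ⇔ InP n (suc k) X Y

pX : ∀ {n k J γ X} → InN n k J γ X → List (List ℕ)
pX w = InN.α w ++ reverse (InN.β w) ++ InN.δ w

-- Let γ = α ++ β ++ δ with β = P_X. Prefixes of p_X(γ) ending outside the reversed block
-- are rearrangements of prefixes of γ. A prefix ending inside it is α ∪ β₂, where
-- β = β₁ ++ β₂ and α, α ∪ β₁, α ∪ β are prefixes of γ. Since two distinct facets lie in
-- at most one common (k+2)-set, P_X' meets β₂ in at most one facet for X' ≠ X, and then
-- P_X' ∩ (α ∪ β₂) equals P_X' ∩ α or P_X' ∩ (α ∪ β). For X' = X it is the complement
-- β₂ of the segment β₁ = P_X ∩ (α ∪ β₁) of P_X, hence again a segment.
module Submission where

open import Defs
open import Data.Nat using (ℕ; suc; _+_; _<_; _≤_; _<?_; _≤?_; z≤n; s≤s)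
open import Data.Nat.Properties
  using (_≟_; <-trans; <⇒≢; <-asym; <-irrefl; ≤-total; ≤-trans; ≤-reflexive; 1+n≰n; m≤n⇒∃[o]m+o≡n; module ≤-Reasoning)
open import Data.List using (List; []; _∷_; length; take; drop; reverse; _++_)
open import Data.List.Properties using (≡-dec; ++-assoc; length-++-sucʳ; reverse-++; reverse-involutive; take++drop≡id)
open import Data.List.Relation.Unary.All as All using (All; _∷_; all?)
open import Data.List.Relation.Unary.All.Properties using (¬Any⇒All¬)
open import Data.List.Relation.Unary.AllPairs using (AllPairs; []; _∷_)
import Data.List.Relation.Unary.AllPairs as AllPairs
open import Data.List.Relation.Unary.Any using (here; there; any?)
open import Data.List.Relation.Unary.Linked using (linked?)
open import Data.List.Relation.Unary.Linked.Properties using (Linked⇒AllPairs)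
open import Data.List.Relation.Unary.Unique.Propositional using (Unique)
open import Data.List.Relation.Binary.Disjoint.Propositional using (Disjoint)
open import Data.List.Relation.Binary.Subset.Propositional using (_⊆_)
open import Data.List.Relation.Binary.Subset.Propositional.Properties using (⊆∷∧∉⇒⊆; xs⊆ys++xs; ++⁺ʳ)
open import Data.List.Membership.Propositional using (_∈_; _∉_; find; lose)
open import Data.List.Membership.Propositional.Properties using (∈-++⁺ˡ; ∈-++⁺ʳ; ∈-++⁻; ∈-∃++)
open import Data.List.Membership.DecPropositional _≟_ using (_∈?_)
open import Data.List.Relation.Binary.Permutation.Propositional using (_↭_; ↭-sym; ↭⇒↭ₛ)
open import Data.List.Relation.Binary.Permutation.Propositional.Properties
  using (∈-resp-↭; ↭-reverse)
  renaming (++⁺ˡ to ↭-++⁺ˡ; ++⁺ʳ to ↭-++⁺ʳ)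
import Data.List.Relation.Binary.Permutation.Setoid.Properties as PermutationSetoid
open import Data.Product using (_,_; proj₁)
open import Data.Sum using (_⊎_; inj₁; inj₂)
open import Data.Empty using (⊥-elim)
open import Relation.Nullary using (¬_; Dec; yes; no)
open import Relation.Nullary.Decidable using (_×-dec_; ¬?)
open import Relation.Binary.PropositionalEquality using (_≡_; _≢_; refl; sym; trans; cong; subst; setoid; module ≡-Reasoning)
open import Function.Base using (_∘′_)
open import Function.Bundles using (_⇔_; mk⇔; Equivalence)

private
  variable
    A : Set
    n m : ℕ
    X : List ℕ

Unique-⊆⇒length≤ : {xs ys : List A} → Unique xs → xs ⊆ ys → length xs ≤ length ys
Unique-⊆⇒length≤ [] _ = z≤n
Unique-⊆⇒length≤ {xs = x ∷ xs} (x∉xs ∷ u) x∷xs⊆ys with ∈-∃++ (x∷xs⊆ys (here refl))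
... | us , vs , refl = begin
    suc (length xs)          ≤⟨ s≤s (Unique-⊆⇒length≤ u xs⊆us++vs) ⟩
    suc (length (us ++ vs))  ≡⟨ sym (length-++-sucʳ us x vs) ⟩
    length (us ++ x ∷ vs)    ∎
  where
  open ≤-Reasoning
  xs⊆us++vs : xs ⊆ us ++ vs
  xs⊆us++vs z∈xs with ∈-++⁻ us (x∷xs⊆ys (there z∈xs))
  ... | inj₁ z∈us         = ∈-++⁺ˡ z∈us
  ... | inj₂ (here refl)  = ⊥-elim (All.lookup x∉xs z∈xs refl)
  ... | inj₂ (there z∈vs) = ∈-++⁺ʳ us z∈vs

Unique-++⇒Disjoint : ∀ (xs : List A) {ys} → Unique (xs ++ ys) → Disjoint xs ys
Unique-++⇒Disjoint (x ∷ xs) (x∉ ∷ _) (here refl , x∈ys) = All.lookup x∉ (∈-++⁺ʳ xs x∈ys) refl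
Unique-++⇒Disjoint (x ∷ xs) (_ ∷ u) (there v∈xs , v∈ys) = Unique-++⇒Disjoint xs u (v∈xs , v∈ys)

Unique-++⁻ˡ : ∀ (xs : List A) {ys} → Unique (xs ++ ys) → Unique xs
Unique-++⁻ˡ []       _          = []
Unique-++⁻ˡ (x ∷ xs) (x∉ ∷ u) = All.tabulate (λ v∈xs → All.lookup x∉ (∈-++⁺ˡ v∈xs)) ∷ Unique-++⁻ˡ xs u

Unique-++⁻ʳ : ∀ (xs : List A) {ys} → Unique (xs ++ ys) → Unique ys
Unique-++⁻ʳ []       u       = u
Unique-++⁻ʳ (x ∷ xs) (_ ∷ u) = Unique-++⁻ʳ xs u

take-++-≤ : ∀ {i} (xs ys : List A) → i ≤ length xs → take i (xs ++ ys) ≡ take i xs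
take-++-≤ {i = 0}     xs       ys _        = refl
take-++-≤ {i = suc i} (x ∷ xs) ys (s≤s i≤) = cong (x ∷_) (take-++-≤ xs ys i≤)

take-length-+-++ : ∀ (xs : List A) {ys} j → take (length xs + j) (xs ++ ys) ≡ xs ++ take j ys
take-length-+-++ []       j = refl
take-length-+-++ (x ∷ xs) j = cong (x ∷_) (take-length-+-++ xs j)

take-length-++ : ∀ (xs : List A) {ys} → take (length xs) (xs ++ ys) ≡ xs
take-length-++ []       = refl
take-length-++ (x ∷ xs) = cong (x ∷_) (take-length-++ xs)

StrictlySorted : List ℕ → Set
StrictlySorted = AllPairs _<_

StrictlySorted⇒Unique : ∀ {xs} → StrictlySorted xs → Unique xs
StrictlySorted⇒Unique = AllPairs.map <⇒≢

StrictlySorted-heads-≡ : ∀ {x y xs ys} → StrictlySorted (x ∷ xs) → StrictlySorted (y ∷ ys) →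
  x ∷ xs ⊆ y ∷ ys → y ∷ ys ⊆ x ∷ xs → x ≡ y
StrictlySorted-heads-≡ (x<xs ∷ _) (y<ys ∷ _) xs⊆ ys⊆ with xs⊆ (here refl) | ys⊆ (here refl)
... | here x≡y   | _          = x≡y
... | there _    | here y≡x   = sym y≡x
... | there x∈ys | there y∈xs = ⊥-elim (<-asym (All.lookup y<ys x∈ys) (All.lookup x<xs y∈xs))

StrictlySorted-⊆-antisym : ∀ {xs ys} → StrictlySorted xs → StrictlySorted ys → xs ⊆ ys → ys ⊆ xs → xs ≡ ys
StrictlySorted-⊆-antisym {[]}    {[]}    _ _ _ _ = refl
StrictlySorted-⊆-antisym {[]}    {_ ∷ _} _ _ _ ys⊆ with () ← ys⊆ (here refl)
StrictlySorted-⊆-antisym {_ ∷ _} {[]}    _ _ xs⊆ _ with () ← xs⊆ (here refl)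
StrictlySorted-⊆-antisym {x ∷ xs} {y ∷ ys} sx@(x<xs ∷ sxs) sy@(y<ys ∷ sys) xs⊆ ys⊆
  with refl ← StrictlySorted-heads-≡ sx sy xs⊆ ys⊆ =
  cong (x ∷_) (StrictlySorted-⊆-antisym sxs sys
    (⊆∷∧∉⇒⊆ (λ v∈xs → xs⊆ (there v∈xs)) (min∉ x<xs))
    (⊆∷∧∉⇒⊆ (λ v∈ys → ys⊆ (there v∈ys)) (min∉ y<ys)))
  where
  min∉ : ∀ {z zs} → All (z <_) zs → z ∉ zs
  min∉ z<zs z∈zs = <-irrefl refl (All.lookup z<zs z∈zs)

⊆∷-of-codim₁ : ∀ {y : ℕ} {Y X} → Unique Y → Y ⊆ X → length X ≤ suc (length Y) → y ∈ X → y ∉ Y → X ⊆ y ∷ Y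
⊆∷-of-codim₁ {y} {Y} {X} uY Y⊆X |X|≤ y∈X y∉Y {z} z∈X with z ∈? Y | z ≟ y
... | yes z∈Y | _        = there z∈Y
... | no _    | yes refl = here refl
... | no z∉Y  | no z≢y   = ⊥-elim (1+n≰n (≤-trans (Unique-⊆⇒length≤ u y∷z∷Y⊆X) |X|≤))
  where
  u : Unique (y ∷ z ∷ Y)
  u = ((z≢y ∘′ sym) ∷ ¬Any⇒All¬ Y y∉Y) ∷ ¬Any⇒All¬ Y z∉Y ∷ uY
  y∷z∷Y⊆X : y ∷ z ∷ Y ⊆ X
  y∷z∷Y⊆X (here refl)         = y∈X
  y∷z∷Y⊆X (there (here refl)) = z∈X
  y∷z∷Y⊆X (there (there v∈Y)) = Y⊆X v∈Y

InC⇒StrictlySorted : ∀ {Y} → InC n m Y → StrictlySorted Y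
InC⇒StrictlySorted (sorted , _) = Linked⇒AllPairs <-trans sorted

InC? : ∀ n m Y → Dec (InC n m Y)
InC? n m Y = linked? _<?_ Y ×-dec all? (λ i → (1 ≤? i) ×-dec (i ≤? n)) Y ×-dec (length Y ≟ m)

InP? : ∀ n m X Y → Dec (InP n m X Y)
InP? n m X Y = InC? n m Y ×-dec all? (_∈? X) Y

distinct-common-facets⇒⊆ : ∀ {X′ Y₀ Y₁} → InC n (suc m) X → InP n m X Y₀ → InP n m X Y₁ →
  InP n m X′ Y₀ → InP n m X′ Y₁ → Y₀ ≢ Y₁ → X ⊆ X′
distinct-common-facets⇒⊆ {n} {m} {X} {X′} {Y₀} {Y₁} (_ , _ , |X|≡) pX₀ pX₁ (_ , Y₀⊆X′) (_ , Y₁⊆X′) Y₀≢Y₁ {y} y∈X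
  with y ∈? Y₀ | y ∈? Y₁
... | yes y∈Y₀ | _        = All.lookup Y₀⊆X′ y∈Y₀
... | no _     | yes y∈Y₁ = All.lookup Y₁⊆X′ y∈Y₁
... | no y∉Y₀  | no y∉Y₁  = ⊥-elim (Y₀≢Y₁ (StrictlySorted-⊆-antisym
        (InC⇒StrictlySorted (proj₁ pX₀)) (InC⇒StrictlySorted (proj₁ pX₁))
        (⊆-other pX₀ pX₁ y∉Y₀ y∉Y₁) (⊆-other pX₁ pX₀ y∉Y₁ y∉Y₀)))
  where
  ⊆-other : ∀ {Y Y′} → InP n m X Y → InP n m X Y′ → y ∉ Y → y ∉ Y′ → Y ⊆ Y′
  ⊆-other (_ , Y⊆X) (cY′@(_ , _ , |Y′|≡) , Y′⊆X) y∉Y y∉Y′ =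
    ⊆∷∧∉⇒⊆ (λ v∈Y → ⊆∷-of-codim₁ (StrictlySorted⇒Unique (InC⇒StrictlySorted cY′))
                                  (All.lookup Y′⊆X) |X|≤ y∈X y∉Y′ (All.lookup Y⊆X v∈Y)) y∉Y
    where
    |X|≤ = ≤-reflexive (trans |X|≡ (cong suc (sym |Y′|≡)))

distinct-common-facets⇒≡ : ∀ {X′ Y₀ Y₁} → InC n (suc m) X → InC n (suc m) X′ →
  InP n m X Y₀ → InP n m X Y₁ → InP n m X′ Y₀ → InP n m X′ Y₁ → Y₀ ≢ Y₁ → X ≡ X′
distinct-common-facets⇒≡ cX cX′ pX₀ pX₁ pX′₀ pX′₁ Y₀≢Y₁ = StrictlySorted-⊆-antisym
  (InC⇒StrictlySorted cX) (InC⇒StrictlySorted cX′)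
  (distinct-common-facets⇒⊆ cX pX₀ pX₁ pX′₀ pX′₁ Y₀≢Y₁)
  (distinct-common-facets⇒⊆ cX′ pX′₀ pX′₁ pX₀ pX₁ Y₀≢Y₁)

Segment : ℕ → ℕ → SetOf → List ℕ → Set
Segment n m A X = InitialIn n m A X ⊎ FinalIn n m A X

Segment-resp : ∀ {A B : SetOf} → (∀ Y → InP n m X Y → A Y → B Y) → (∀ Y → InP n m X Y → B Y → A Y) →
  Segment n m A X → Segment n m B X
Segment-resp A⇒B B⇒A (inj₁ initial) = inj₁ λ Y Y′ p p′ Y′<Y bY → A⇒B Y′ p′ (initial Y Y′ p p′ Y′<Y (B⇒A Y p bY))
Segment-resp A⇒B B⇒A (inj₂ final)   = inj₂ λ Y Y′ p p′ Y<Y′ bY → A⇒B Y′ p′ (final Y Y′ p p′ Y<Y′ (B⇒A Y p bY))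

Segment-complement : ∀ {A B : SetOf} → (∀ Y → InP n m X Y → B Y → ¬ A Y) → (∀ Y → InP n m X Y → ¬ A Y → B Y) →
  Segment n m A X → Segment n m B X
Segment-complement B⇒¬A ¬A⇒B (inj₁ initial) =
  inj₂ λ Y Y′ p p′ Y<Y′ bY → ¬A⇒B Y′ p′ λ aY′ → B⇒¬A Y p bY (initial Y′ Y p′ p Y<Y′ aY′)
Segment-complement B⇒¬A ¬A⇒B (inj₂ final) =
  inj₁ λ Y Y′ p p′ Y′<Y bY → ¬A⇒B Y′ p′ λ aY′ → B⇒¬A Y p bY (final Y′ Y p′ p Y′<Y aY′)

RealizableList : ℕ → ℕ → List (List ℕ) → Set
RealizableList n m xs = Realizable n m ⟦ xs ⟧

RealizablePrefixes : ℕ → ℕ → List (List ℕ) → Set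
RealizablePrefixes n m γ = ∀ i → RealizableList n m (take i γ)

RealizableList-resp-↭ : ∀ {xs ys} → xs ↭ ys → RealizableList n m xs → RealizableList n m ys
RealizableList-resp-↭ xs↭ys (inC , segment) =
  (λ Y Y∈ys → inC Y (∈-resp-↭ (↭-sym xs↭ys) Y∈ys)) ,
  λ X cX → Segment-resp (λ _ _ → ∈-resp-↭ xs↭ys) (λ _ _ → ∈-resp-↭ (↭-sym xs↭ys)) (segment X cX)

prefix-realizable : ∀ xs ys {γ} → xs ++ ys ≡ γ → RealizablePrefixes n m γ → RealizableList n m xs
prefix-realizable {n} {m} xs ys refl R = subst (RealizableList n m) (take-length-++ xs) (R (length xs))

blockSuffix-segment : ∀ α β₁ β₂ → (∀ Y → InP n m X Y → Y ∈ β₁ ++ β₂) →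
  Disjoint α (β₁ ++ β₂) → Disjoint β₁ β₂ → Segment n m ⟦ α ++ β₁ ⟧ X → Segment n m ⟦ α ++ β₂ ⟧ X
blockSuffix-segment {n} {m} {X} α β₁ β₂ P⊆β α#β β₁#β₂ = Segment-complement outside-α++β₁ inside-α++β₂
  where
  ∉α : ∀ {Y} → InP n m X Y → Y ∉ α
  ∉α p Y∈α = α#β (Y∈α , P⊆β _ p)
  outside-α++β₁ : ∀ Y → InP n m X Y → Y ∈ α ++ β₂ → Y ∉ α ++ β₁
  outside-α++β₁ Y p Y∈α++β₂ Y∈α++β₁ with ∈-++⁻ α Y∈α++β₂ | ∈-++⁻ α Y∈α++β₁
  ... | inj₁ Y∈α  | _         = ∉α p Y∈α
  ... | _         | inj₁ Y∈α  = ∉α p Y∈α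
  ... | inj₂ Y∈β₂ | inj₂ Y∈β₁ = β₁#β₂ (Y∈β₁ , Y∈β₂)
  inside-α++β₂ : ∀ Y → InP n m X Y → Y ∉ α ++ β₁ → Y ∈ α ++ β₂
  inside-α++β₂ Y p Y∉α++β₁ with ∈-++⁻ β₁ (P⊆β Y p)
  ... | inj₁ Y∈β₁ = ⊥-elim (Y∉α++β₁ (∈-++⁺ʳ α Y∈β₁))
  ... | inj₂ Y∈β₂ = ∈-++⁺ʳ α Y∈β₂

blockSuffix-realizable : ∀ α β₁ β₂ {β} → β₁ ++ β₂ ≡ β → InC n (suc m) X →
  (∀ Y → (Y ∈ β) ⇔ InP n m X Y) → Disjoint α β → Unique β →
  RealizableList n m α → RealizableList n m (α ++ β₁) → RealizableList n m (α ++ β) →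
  RealizableList n m (α ++ β₂)
blockSuffix-realizable {n} {m} {X} α β₁ β₂ refl cX block α#β uβ (_ , segα) (_ , segα₁) (inCαβ , segαβ) =
  (λ Y Y∈ → inCαβ Y (α++β₂⊆α++β Y∈)) , segment
  where
  β = β₁ ++ β₂
  α++β₂⊆α++β : α ++ β₂ ⊆ α ++ β
  α++β₂⊆α++β = ++⁺ʳ α (xs⊆ys++xs β₂ β₁)
  segment : ∀ X′ → InC n (suc m) X′ → Segment n m ⟦ α ++ β₂ ⟧ X′
  segment X′ cX′ with any? (InP? n m X′) β₂
  ... | no P∩β₂≡∅ = Segment-resp (λ _ _ → ∈-++⁺ˡ) in-α (segα X′ cX′)
    where
    in-α : ∀ Y → InP n m X′ Y → Y ∈ α ++ β₂ → Y ∈ α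
    in-α Y p Y∈ with ∈-++⁻ α Y∈
    ... | inj₁ Y∈α  = Y∈α
    ... | inj₂ Y∈β₂ = ⊥-elim (P∩β₂≡∅ (lose Y∈β₂ p))
  ... | yes P∩β₂≢∅ with find P∩β₂≢∅
  ... | Y₀ , Y₀∈β₂ , p₀ with any? (λ Y → ¬? (≡-dec _≟_ Y Y₀) ×-dec InP? n m X′ Y) β
  ... | no P∩β⊆[Y₀] = Segment-resp drop-β₁ (λ _ _ → α++β₂⊆α++β) (segαβ X′ cX′)
    where
    drop-β₁ : ∀ Y → InP n m X′ Y → Y ∈ α ++ β → Y ∈ α ++ β₂
    drop-β₁ Y p Y∈ with ∈-++⁻ α Y∈ | ≡-dec _≟_ Y Y₀
    ... | inj₁ Y∈α | _        = ∈-++⁺ˡ Y∈α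
    ... | inj₂ _   | yes refl = ∈-++⁺ʳ α Y₀∈β₂
    ... | inj₂ Y∈β | no Y≢Y₀  = ⊥-elim (P∩β⊆[Y₀] (lose Y∈β (Y≢Y₀ , p)))
  ... | yes P∩β∖[Y₀]≢∅ with find P∩β∖[Y₀]≢∅
  ... | Y₁ , Y₁∈β , Y₁≢Y₀ , p₁ with distinct-common-facets⇒≡ cX cX′
               (Equivalence.to (block Y₁) Y₁∈β) (Equivalence.to (block Y₀) (∈-++⁺ʳ β₁ Y₀∈β₂)) p₁ p₀ Y₁≢Y₀
  ... | refl = blockSuffix-segment α β₁ β₂ (λ Y → Equivalence.from (block Y)) α#β (Unique-++⇒Disjoint β₁ uβ) (segα₁ X cX)

module _ {n m : ℕ} (α β δ : List (List ℕ)) {X : List ℕ} (cX : InC n (suc m) X)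
         (block : ∀ Y → (Y ∈ β) ⇔ InP n m X Y) (u : Unique (α ++ β ++ δ))
         (R : RealizablePrefixes n m (α ++ β ++ δ)) where

  open ≡-Reasoning

  private
    α#β : Disjoint α β
    α#β (Y∈α , Y∈β) = Unique-++⇒Disjoint α u (Y∈α , ∈-++⁺ˡ Y∈β)

    uβ : Unique β
    uβ = Unique-++⁻ˡ β (Unique-++⁻ʳ α u)

  prefix-inside-reversedBlock : ∀ j → RealizableList n m (α ++ take j (reverse β))
  prefix-inside-reversedBlock j =
    RealizableList-resp-↭ (↭-++⁺ˡ α (↭-reverse ρ₁))
      (blockSuffix-realizable α β₁ (reverse ρ₁) β₁++reverse-ρ₁≡β cX block α#β uβ
        (prefix-realizable α (β ++ δ) refl R)
        (prefix-realizable (α ++ β₁) (reverse ρ₁ ++ δ) splitAt-β₁ R)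
        (prefix-realizable (α ++ β) δ (++-assoc α β δ) R))
    where
    ρ₁ = take j (reverse β)
    β₁ = reverse (drop j (reverse β))
    β₁++reverse-ρ₁≡β : β₁ ++ reverse ρ₁ ≡ β
    β₁++reverse-ρ₁≡β = begin
      reverse (drop j (reverse β)) ++ reverse ρ₁  ≡⟨ reverse-++ ρ₁ (drop j (reverse β)) ⟨
      reverse (ρ₁ ++ drop j (reverse β))          ≡⟨ cong reverse (take++drop≡id j (reverse β)) ⟩
      reverse (reverse β)                         ≡⟨ reverse-involutive β ⟩
      β                                           ∎
    splitAt-β₁ : (α ++ β₁) ++ reverse ρ₁ ++ δ ≡ α ++ β ++ δ
    splitAt-β₁ = begin
      (α ++ β₁) ++ reverse ρ₁ ++ δ  ≡⟨ ++-assoc α β₁ _ ⟩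
      α ++ β₁ ++ reverse ρ₁ ++ δ    ≡⟨ cong (α ++_) (++-assoc β₁ _ δ) ⟨
      α ++ (β₁ ++ reverse ρ₁) ++ δ  ≡⟨ cong (λ b → α ++ b ++ δ) β₁++reverse-ρ₁≡β ⟩
      α ++ β ++ δ                   ∎

  prefix-after-reversedBlock : ∀ l → RealizableList n m (α ++ reverse β ++ take l δ)
  prefix-after-reversedBlock l =
    RealizableList-resp-↭ (↭-++⁺ˡ α (↭-++⁺ʳ (take l δ) (↭-sym (↭-reverse β))))
      (prefix-realizable (α ++ β ++ take l δ) (drop l δ) splitAt-l R)
    where
    splitAt-l : (α ++ β ++ take l δ) ++ drop l δ ≡ α ++ β ++ δ
    splitAt-l = begin
      (α ++ β ++ take l δ) ++ drop l δ  ≡⟨ ++-assoc α _ _ ⟩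
      α ++ (β ++ take l δ) ++ drop l δ  ≡⟨ cong (α ++_) (++-assoc β _ _) ⟩
      α ++ β ++ take l δ ++ drop l δ    ≡⟨ cong (λ d → α ++ β ++ d) (take++drop≡id l δ) ⟩
      α ++ β ++ δ                       ∎

  prefix-of-reversedBlock++δ : ∀ j → RealizableList n m (α ++ take j (reverse β ++ δ))
  prefix-of-reversedBlock++δ j with ≤-total j (length (reverse β))
  ... | inj₁ j≤|β| =
    subst (RealizableList n m) (cong (α ++_) (sym (take-++-≤ (reverse β) δ j≤|β|))) (prefix-inside-reversedBlock j)
  ... | inj₂ |β|≤j with m≤n⇒∃[o]m+o≡n |β|≤j
  ... | l , refl =
    subst (RealizableList n m) (cong (α ++_) (sym (take-length-+-++ (reverse β) l))) (prefix-after-reversedBlock l)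

  reverseBlock-realizablePrefixes : RealizablePrefixes n m (α ++ reverse β ++ δ)
  reverseBlock-realizablePrefixes i with ≤-total i (length α)
  ... | inj₁ i≤|α| =
    subst (RealizableList n m) (trans (take-++-≤ α _ i≤|α|) (sym (take-++-≤ α _ i≤|α|))) (R i)
  ... | inj₂ |α|≤i with m≤n⇒∃[o]m+o≡n |α|≤i
  ... | j , refl =
    subst (RealizableList n m) (sym (take-length-+-++ α j)) (prefix-of-reversedBlock++δ j)

reverseBlock-isPath : ∀ {n k J} α β δ {X} → InC n (suc (suc k)) X → (∀ Y → (Y ∈ β) ⇔ InP n (suc k) X Y) →
  IsPath n k J (α ++ β ++ δ) → IsPath n k J (α ++ reverse β ++ δ)
reverseBlock-isPath α β δ cX block (u , members , R) =
  PermutationSetoid.Unique-resp-↭ (setoid _) (↭⇒↭ₛ reversal) u ,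
  (λ Y → mk⇔ (Equivalence.to (members Y) ∘′ ∈-resp-↭ (↭-sym reversal))
             (∈-resp-↭ reversal ∘′ Equivalence.from (members Y))) ,
  reverseBlock-realizablePrefixes α β δ cX block u R
  where
  reversal : α ++ β ++ δ ↭ α ++ reverse β ++ δ
  reversal = ↭-++⁺ˡ α (↭-++⁺ʳ δ (↭-sym (↭-reverse β)))

lemma3p7 : (n k : ℕ) (J : SetOf) → Realizable n (suc k) J →
    (γ : List (List ℕ)) → IsPath n k J γ →
    (X : List ℕ) (xN : InN n k J γ X) →
    IsPath n k J (pX xN)
lemma3p7 n k J _ γ path X xN =
  reverseBlock-isPath α β δ (proj₁ inJF) block (subst (IsPath n k J) split path)
  where open InN xN
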